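{- For every positive integer $h$, the diameter of the multiplicative circulant graph $MC(3^h)$ is $h$.
   Context: For integers $m>1$, $h>0$, $MC(m^h)$ is the graph with vertex set $\mathbb{Z}_{m^h}$ in which distinct vertices $x,y$ are adjacent iff $x-y\equiv \pm m^i \pmod{m^h}$ for some $i\in\{0,\ldots,h-1\}$. The diameter is the maximum distance (shortest path length) between any pair of vertices. -}

module Defs where

open import Data.Nat using (ℕ; zero; suc; _<_; _≤_; _^_)
open import Data.Integer as ℤ using (ℤ; +_)
open import Data.Integer.Divisibility using () renaming (_∣_ to _∣ℤ_)
open import Data.Product using (Σ; ∃; ∃-syntax; _×_; _,_)
open import Data.Sum using (_⊎_)
open import Relation.Binary.PropositionalEquality using (_≡_; _≢_)

-- Vertices of MC(m^h) are the naturals x < m^h (representatives of ℤ_{m^h}).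
-- Distinct x, y are adjacent iff x - y ≡ ± m^i (mod m^h) for some i ∈ {0,…,h-1}.
MCAdj : ℕ → ℕ → ℕ → ℕ → Set
MCAdj m h x y =
  x < m ^ h × y < m ^ h × x ≢ y ×
  ∃[ i ] (i < h ×
    ((+ (m ^ h) ∣ℤ ((+ x ℤ.- + y) ℤ.- + (m ^ i)))
     ⊎ (+ (m ^ h) ∣ℤ ((+ x ℤ.- + y) ℤ.+ + (m ^ i)))))

data Walk (m h : ℕ) : ℕ → ℕ → ℕ → Set where
  here : ∀ {x} → x < m ^ h → Walk m h zero x x
  step : ∀ {k x y z} → MCAdj m h x y → Walk m h k y z → Walk m h (suc k) x z

DistLe : ℕ → ℕ → ℕ → ℕ → ℕ → Set
DistLe m h x y d = ∃[ k ] (k ≤ d × Walk m h k x y)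

HasDiameter : ℕ → ℕ → ℕ → Set
HasDiameter m h D =
  (∀ x y → x < m ^ h → y < m ^ h → DistLe m h x y D)
  × ∃[ x ] ∃[ y ] (x < m ^ h × y < m ^ h × (∀ k → Walk m h k x y → D ≤ k))

-- Every integer has a balanced ternary expansion with digits -1, 0, 1, and the
-- number of nonzero digits among the lowest h of them is a weight on ℤ/3^h
-- that changes by at most one when ±3^i is added.  Along a walk of MC(3^h) the
-- weight of x - z therefore drops by at most one per edge, so the vertex
-- (3^h - 1)/2 = 11…1 in ternary, of weight h, is at distance at least h from 0.
-- Conversely, from v one reaches y by cancelling the balanced ternary digits of
-- v - y from the lowest upwards, one edge per nonzero digit, in at most h steps.
module Submission where

open import Defs
open import Data.Empty using (⊥-elim)
open import Data.Integer as ℤ using (ℤ; +_; _+_; _*_; -_; _-_; ∣_∣)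
import Data.Integer.Properties as ℤP
open import Data.Integer.DivMod using (_%ℕ_; _/ℕ_; a≡a%ℕn+[a/ℕn]*n; n%ℕd<d)
open import Data.Integer.Divisibility.Signed
  using (_∣_; divides; ∣ᵤ⇒∣; ∣⇒∣ᵤ; ∣-trans; ∣m⇒∣-m; ∣m∣n⇒∣m-n)
open import Data.Integer.Tactic.RingSolver using (solve-∀)
open import Data.Nat as ℕ using (ℕ; zero; suc; z≤n; s≤s; _<_; _≤_; _^_; _∸_)
import Data.Nat.Divisibility as ℕD
import Data.Nat.Properties as ℕP
import Data.Nat.Tactic.RingSolver as ℕSolver
open import Data.Product using (∃-syntax; ∃₂; _×_; _,_)
open import Data.Sum as Sum using (_⊎_; inj₁; inj₂; [_,_])
open import Relation.Binary.PropositionalEquality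
  using (_≡_; _≢_; refl; sym; trans; cong; cong₂; subst; module ≡-Reasoning)
open import Relation.Nullary using (¬_)

3^_ : ℕ → ℤ
3^ i = + (3 ^ i)

3^-suc : ∀ i → 3^ suc i ≡ + 3 * 3^ i
3^-suc i = ℤP.pos-* 3 (3 ^ i)

3^-mono-∣ : ∀ {m n} → m ≤ n → 3^ m ∣ 3^ n
3^-mono-∣ {m} {n} m≤n = ∣ᵤ⇒∣ (subst (λ k → 3 ^ m ℕD.∣ 3 ^ k) (ℕP.m+[n∸m]≡n m≤n)
  (subst (3 ^ m ℕD.∣_) (sym (ℕP.^-distribˡ-+-* 3 m (n ∸ m))) (ℕD.m∣m*n (3 ^ (n ∸ m)))))

3^∤3^ : ∀ {i h} → i < h → ¬ (3^ h ∣ 3^ i)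
3^∤3^ {i} i<h 3^h∣3^i =
  ℕP.<⇒≱ (ℕP.^-monoʳ-< 3 (s≤s (s≤s z≤n)) i<h)
         (ℕD.∣⇒≤ {{ℕP.m^n≢0 3 i}} (∣⇒∣ᵤ 3^h∣3^i))

data Trit : Set where
  -1ₜ 0ₜ +1ₜ : Trit

toℤ : Trit → ℤ
toℤ -1ₜ = - + 1
toℤ 0ₜ  = + 0
toℤ +1ₜ = + 1

negate : Trit → Trit
negate -1ₜ = +1ₜ
negate 0ₜ  = 0ₜ
negate +1ₜ = -1ₜ

toℤ-negate : ∀ r → toℤ (negate r) ≡ - toℤ r
toℤ-negate -1ₜ = refl
toℤ-negate 0ₜ  = refl
toℤ-negate +1ₜ = refl

∣toℤ-negate∣ : ∀ r → ∣ toℤ (negate r) ∣ ≡ ∣ toℤ r ∣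
∣toℤ-negate∣ -1ₜ = refl
∣toℤ-negate∣ 0ₜ  = refl
∣toℤ-negate∣ +1ₜ = refl

3∤1 : ¬ (3 ℕD.∣ 1)
3∤1 = ℕD.>⇒∤ (s≤s (s≤s z≤n))

3∤2 : ¬ (3 ℕD.∣ 2)
3∤2 = ℕD.>⇒∤ (s≤s (s≤s (s≤s z≤n)))

3∣toℤ-difference⇒≡ : ∀ r s → + 3 ∣ toℤ r - toℤ s → r ≡ s
3∣toℤ-difference⇒≡ -1ₜ -1ₜ _ = refl
3∣toℤ-difference⇒≡ -1ₜ 0ₜ  d = ⊥-elim (3∤1 (∣⇒∣ᵤ d))
3∣toℤ-difference⇒≡ -1ₜ +1ₜ d = ⊥-elim (3∤2 (∣⇒∣ᵤ d))
3∣toℤ-difference⇒≡ 0ₜ  -1ₜ d = ⊥-elim (3∤1 (∣⇒∣ᵤ d))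
3∣toℤ-difference⇒≡ 0ₜ  0ₜ  _ = refl
3∣toℤ-difference⇒≡ 0ₜ  +1ₜ d = ⊥-elim (3∤1 (∣⇒∣ᵤ d))
3∣toℤ-difference⇒≡ +1ₜ -1ₜ d = ⊥-elim (3∤2 (∣⇒∣ᵤ d))
3∣toℤ-difference⇒≡ +1ₜ 0ₜ  d = ⊥-elim (3∤1 (∣⇒∣ᵤ d))
3∣toℤ-difference⇒≡ +1ₜ +1ₜ _ = refl

infixr 5 _◂_
_◂_ : Trit → ℤ → ℤ
r ◂ q = toℤ r + + 3 * q

balanced-split : ∀ n → ∃₂ λ r q → n ≡ r ◂ q
balanced-split n with n %ℕ 3 | a≡a%ℕn+[a/ℕn]*n n 3 | n%ℕd<d n 3
... | 0 | n≡ | _ = 0ₜ  , n /ℕ 3 , trans n≡ (cong (_+_ (+ 0)) (ℤP.*-comm (n /ℕ 3) (+ 3)))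
... | 1 | n≡ | _ = +1ₜ , n /ℕ 3 , trans n≡ (cong (_+_ (+ 1)) (ℤP.*-comm (n /ℕ 3) (+ 3)))
... | 2 | n≡ | _ = -1ₜ , n /ℕ 3 + + 1 , trans n≡ (borrow (n /ℕ 3))
  where
  borrow : ∀ q → + 2 + q * + 3 ≡ - + 1 + + 3 * (q + + 1)
  borrow = solve-∀
... | suc (suc (suc _)) | _ | s≤s (s≤s (s≤s ()))

◂-≡⇒toℤ-difference : ∀ r s q p → r ◂ q ≡ s ◂ p → toℤ r - toℤ s ≡ (p - q) * + 3
◂-≡⇒toℤ-difference r s q p eq = begin
  toℤ r - toℤ s                          ≡⟨ rearrange (toℤ r) (toℤ s) q p ⟩
  ((r ◂ q) - (s ◂ p)) + (p - q) * + 3    ≡⟨ cong (λ t → (t - (s ◂ p)) + (p - q) * + 3) eq ⟩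
  ((s ◂ p) - (s ◂ p)) + (p - q) * + 3    ≡⟨ cong (_+ (p - q) * + 3) (ℤP.+-inverseʳ (s ◂ p)) ⟩
  + 0 + (p - q) * + 3                    ≡⟨ ℤP.+-identityˡ _ ⟩
  (p - q) * + 3                          ∎
  where
  open ≡-Reasoning
  rearrange : ∀ a b q p → a - b ≡ ((a + + 3 * q) - (b + + 3 * p)) + (p - q) * + 3
  rearrange = solve-∀

◂-injective : ∀ {r s q p} → r ◂ q ≡ s ◂ p → r ≡ s × q ≡ p
◂-injective {r} {s} {q} {p} eq = r≡s , q≡p
  where
  r-s≡[p-q]*3 : toℤ r - toℤ s ≡ (p - q) * + 3
  r-s≡[p-q]*3 = ◂-≡⇒toℤ-difference r s q p eq
  r≡s : r ≡ s
  r≡s = 3∣toℤ-difference⇒≡ r s (divides (p - q) r-s≡[p-q]*3)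
  [p-q]*3≡0 : (p - q) * + 3 ≡ + 0
  [p-q]*3≡0 = trans (sym r-s≡[p-q]*3) (ℤP.i≡j⇒i-j≡0 (cong toℤ r≡s))
  q≡p : q ≡ p
  q≡p = sym (ℤP.i-j≡0⇒i≡j p q (ℤP.*-cancelʳ-≡ (p - q) (+ 0) (+ 3) [p-q]*3≡0))

weight : ℕ → ℤ → ℕ
weight zero    n = 0
weight (suc h) n = let r , q , _ = balanced-split n in ∣ toℤ r ∣ ℕ.+ weight h q

weight-unfold : ∀ h {n} r q → n ≡ r ◂ q → weight (suc h) n ≡ ∣ toℤ r ∣ ℕ.+ weight h q
weight-unfold h {n} r q n≡r◂q =
  let r′ , q′ , n≡r′◂q′ = balanced-split n
      r′≡r , q′≡q = ◂-injective {r′} {r} {q′} {q} (trans (sym n≡r′◂q′) n≡r◂q)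
  in cong₂ (λ r q → ∣ toℤ r ∣ ℕ.+ weight h q) r′≡r q′≡q

weight-0 : ∀ h → weight h (+ 0) ≡ 0
weight-0 zero    = refl
weight-0 (suc h) = trans (weight-unfold h 0ₜ (+ 0) refl) (weight-0 h)

neg-◂ : ∀ r q → - (r ◂ q) ≡ negate r ◂ - q
neg-◂ r q = begin
  - (toℤ r + + 3 * q)       ≡⟨ distrib (toℤ r) q ⟩
  - toℤ r + + 3 * - q       ≡⟨ cong (_+ + 3 * - q) (toℤ-negate r) ⟨
  toℤ (negate r) + + 3 * - q ∎
  where
  open ≡-Reasoning
  distrib : ∀ a q → - (a + + 3 * q) ≡ - a + + 3 * - q
  distrib = solve-∀

weight-neg : ∀ h n → weight h (- n) ≡ weight h n
weight-neg zero    n = refl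
weight-neg (suc h) n = let r , q , n≡r◂q = balanced-split n in begin
  weight (suc h) (- n)
    ≡⟨ weight-unfold h (negate r) (- q) (trans (cong -_ n≡r◂q) (neg-◂ r q)) ⟩
  ∣ toℤ (negate r) ∣ ℕ.+ weight h (- q)    ≡⟨ cong₂ ℕ._+_ (∣toℤ-negate∣ r) (weight-neg h q) ⟩
  ∣ toℤ r ∣ ℕ.+ weight h q                 ≡⟨ weight-unfold h r q n≡r◂q ⟨
  weight (suc h) n                         ∎
  where open ≡-Reasoning

◂-+-3* : ∀ r q d → (r ◂ q) + + 3 * d ≡ r ◂ (q + d)
◂-+-3* r = shift (toℤ r)
  where
  shift : ∀ a q d → (a + + 3 * q) + + 3 * d ≡ a + + 3 * (q + d)
  shift = solve-∀

weight-periodic : ∀ h n j → weight h (n + j * 3^ h) ≡ weight h n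
weight-periodic zero    n j = refl
weight-periodic (suc h) n j = let r , q , n≡r◂q = balanced-split n in begin
  weight (suc h) (n + j * 3^ suc h)
    ≡⟨ weight-unfold h r _ (trans (cong₂ _+_ n≡r◂q j*3^suc) (◂-+-3* r q _)) ⟩
  ∣ toℤ r ∣ ℕ.+ weight h (q + j * 3^ h)  ≡⟨ cong (∣ toℤ r ∣ ℕ.+_) (weight-periodic h q j) ⟩
  ∣ toℤ r ∣ ℕ.+ weight h q               ≡⟨ weight-unfold h r q n≡r◂q ⟨
  weight (suc h) n                       ∎
  where
  open ≡-Reasoning
  j*3^suc : j * 3^ suc h ≡ + 3 * (j * 3^ h)
  j*3^suc = trans (cong (j *_) (3^-suc h)) (swap j (3^ h))
    where
    swap : ∀ j P → j * (+ 3 * P) ≡ + 3 * (j * P)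
    swap = solve-∀

weight-cong : ∀ h {m n} → 3^ h ∣ m - n → weight h m ≡ weight h n
weight-cong h {m} {n} (divides j m-n≡j*3^h) = begin
  weight h m                 ≡⟨ cong (weight h) (m≡n+[m-n] m n) ⟩
  weight h (n + (m - n))     ≡⟨ cong (λ d → weight h (n + d)) m-n≡j*3^h ⟩
  weight h (n + j * 3^ h)    ≡⟨ weight-periodic h n j ⟩
  weight h n                 ∎
  where
  open ≡-Reasoning
  m≡n+[m-n] : ∀ m n → m ≡ n + (m - n)
  m≡n+[m-n] = solve-∀

◂-suc-−1ₜ : ∀ q → (-1ₜ ◂ q) + 3^ 0 ≡ 0ₜ ◂ q
◂-suc-−1ₜ = identity
  where
  identity : ∀ q → (- + 1 + + 3 * q) + + 1 ≡ + 0 + + 3 * q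
  identity = solve-∀

◂-suc-0ₜ : ∀ q → (0ₜ ◂ q) + 3^ 0 ≡ +1ₜ ◂ q
◂-suc-0ₜ = identity
  where
  identity : ∀ q → (+ 0 + + 3 * q) + + 1 ≡ + 1 + + 3 * q
  identity = solve-∀

◂-suc-+1ₜ : ∀ q → (+1ₜ ◂ q) + 3^ 0 ≡ -1ₜ ◂ (q + 3^ 0)
◂-suc-+1ₜ = identity
  where
  identity : ∀ q → (+ 1 + + 3 * q) + + 1 ≡ - + 1 + + 3 * (q + + 1)
  identity = solve-∀

◂-+3^suc : ∀ r q i → (r ◂ q) + 3^ suc i ≡ r ◂ (q + 3^ i)
◂-+3^suc r q i = trans (cong (_+_ (r ◂ q)) (3^-suc i)) (◂-+-3* r q (3^ i))

weight-+3^ : ∀ h i n → weight h (n + 3^ i) ≤ suc (weight h n)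
weight-+3^ zero    _       _ = z≤n
weight-+3^ (suc h) zero    n with balanced-split n
... | -1ₜ , q , refl rewrite weight-unfold h 0ₜ q (◂-suc-−1ₜ q) = ℕP.m≤n+m (weight h q) 2
... | 0ₜ  , q , refl rewrite weight-unfold h +1ₜ q (◂-suc-0ₜ q) = ℕP.≤-refl
... | +1ₜ , q , refl rewrite weight-unfold h -1ₜ (q + 3^ 0) (◂-suc-+1ₜ q) = s≤s (weight-+3^ h 0 q)
weight-+3^ (suc h) (suc i) n with balanced-split n
... | r , q , refl rewrite weight-unfold h r (q + 3^ i) (◂-+3^suc r q i) =
  ℕP.≤-trans (ℕP.+-monoʳ-≤ ∣ toℤ r ∣ (weight-+3^ h i q)) (ℕP.≤-reflexive (ℕP.+-suc _ _))

weight-−3^ : ∀ h i n → weight h (n - 3^ i) ≤ suc (weight h n)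
weight-−3^ h i n = begin
  weight h (n - 3^ i)            ≡⟨ cong (weight h) (reflect n (3^ i)) ⟩
  weight h (- (- n + 3^ i))      ≡⟨ weight-neg h (- n + 3^ i) ⟩
  weight h (- n + 3^ i)          ≤⟨ weight-+3^ h i (- n) ⟩
  suc (weight h (- n))           ≡⟨ cong suc (weight-neg h n) ⟩
  suc (weight h n)               ∎
  where
  open ℕP.≤-Reasoning
  reflect : ∀ n d → n - d ≡ - (- n + d)
  reflect = solve-∀

weight-adjacent : ∀ {h x y} z → MCAdj 3 h x y → weight h (+ x - + z) ≤ suc (weight h (+ y - + z))
weight-adjacent {h} {x} {y} z (_ , _ , _ , i , _ , inj₁ 3^h∣x-y-3^i) = begin
  weight h (+ x - + z)
    ≡⟨ weight-cong h (subst (3^ h ∣_) (regroup (+ x) (+ y) (+ z) (3^ i)) (∣ᵤ⇒∣ 3^h∣x-y-3^i)) ⟩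
  weight h ((+ y - + z) + 3^ i)       ≤⟨ weight-+3^ h i (+ y - + z) ⟩
  suc (weight h (+ y - + z))          ∎
  where
  open ℕP.≤-Reasoning
  regroup : ∀ x y z d → (x - y) - d ≡ (x - z) - ((y - z) + d)
  regroup = solve-∀
weight-adjacent {h} {x} {y} z (_ , _ , _ , i , _ , inj₂ 3^h∣x-y+3^i) = begin
  weight h (+ x - + z)
    ≡⟨ weight-cong h (subst (3^ h ∣_) (regroup (+ x) (+ y) (+ z) (3^ i)) (∣ᵤ⇒∣ 3^h∣x-y+3^i)) ⟩
  weight h ((+ y - + z) - 3^ i)       ≤⟨ weight-−3^ h i (+ y - + z) ⟩
  suc (weight h (+ y - + z))          ∎
  where
  open ℕP.≤-Reasoning
  regroup : ∀ x y z d → (x - y) + d ≡ (x - z) - ((y - z) - d)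
  regroup = solve-∀

weight-walk : ∀ {h k x z} → Walk 3 h k x z → weight h (+ x - + z) ≤ k
weight-walk {h} {x = x} (here _) = ℕP.≤-reflexive (trans (cong (weight h) (ℤP.+-inverseʳ (+ x))) (weight-0 h))
weight-walk {z = z} (step x~y y⇝z) = ℕP.≤-trans (weight-adjacent z x~y) (s≤s (weight-walk y⇝z))

repunit : ℕ → ℕ
repunit zero    = 0
repunit (suc h) = 1 ℕ.+ 3 ℕ.* repunit h

1+2*repunit≡3^ : ∀ h → 1 ℕ.+ 2 ℕ.* repunit h ≡ 3 ^ h
1+2*repunit≡3^ zero    = refl
1+2*repunit≡3^ (suc h) = trans (expand (repunit h)) (cong (3 ℕ.*_) (1+2*repunit≡3^ h))
  where
  expand : ∀ r → 1 ℕ.+ 2 ℕ.* (1 ℕ.+ 3 ℕ.* r) ≡ 3 ℕ.* (1 ℕ.+ 2 ℕ.* r)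
  expand = ℕSolver.solve-∀

repunit<3^ : ∀ h → repunit h < 3 ^ h
repunit<3^ h = subst (repunit h <_) (1+2*repunit≡3^ h) (s≤s (ℕP.m≤m+n (repunit h) _))

weight-repunit : ∀ h → weight h (+ repunit h) ≡ h
weight-repunit zero    = refl
weight-repunit (suc h) =
  trans (weight-unfold h +1ₜ (+ repunit h) +repunit-suc) (cong suc (weight-repunit h))
  where
  +repunit-suc : + repunit (suc h) ≡ +1ₜ ◂ + repunit h
  +repunit-suc = trans (ℤP.pos-+ 1 (3 ℕ.* repunit h)) (cong (_+_ (+ 1)) (ℤP.pos-* 3 (repunit h)))

∣⊖∣< : ∀ {m n N} → m < N → n < N → ∣ m ℤ.⊖ n ∣ < N
∣⊖∣< {m} {n} m<N n<N with ℕP.≤-total m n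
... | inj₁ m≤n = subst (_< _) (sym (ℤP.∣⊖∣-≤ m≤n)) (ℕP.≤-<-trans (ℕP.m∸n≤m n m) n<N)
... | inj₂ n≤m = subst (_< _) (trans (sym (ℤP.∣⊖∣-≤ n≤m)) (ℤP.∣m⊖n∣≡∣n⊖m∣ n m))
                       (ℕP.≤-<-trans (ℕP.m∸n≤m m n) m<N)

∣∧<⇒≡0 : ∀ {N d} → N ℕD.∣ d → d < N → d ≡ 0
∣∧<⇒≡0 {d = zero}  _   _   = refl
∣∧<⇒≡0 {d = suc _} N∣d d<N = ⊥-elim (ℕD.>⇒∤ d<N N∣d)

≡-mod⇒≡ : ∀ {N x y} → x < N → y < N → + N ∣ + x - + y → x ≡ y
≡-mod⇒≡ {N} {x} {y} x<N y<N N∣x-y =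
  ℤP.+-injective (ℤP.i-j≡0⇒i≡j (+ x) (+ y) (ℤP.∣i∣≡0⇒i≡0 (∣∧<⇒≡0 (∣⇒∣ᵤ N∣x-y) ∣x-y∣<N)))
  where
  ∣x-y∣<N : ∣ + x - + y ∣ < N
  ∣x-y∣<N = subst (_< N) (cong ∣_∣ (sym (ℤP.m-n≡m⊖n x y))) (∣⊖∣< x<N y<N)

MCAdj-intro : ∀ {h i x y} → i < h → x < 3 ^ h → y < 3 ^ h →
              (3^ h ∣ (+ x - + y) - 3^ i) ⊎ (3^ h ∣ (+ x - + y) + 3^ i) → MCAdj 3 h x y
MCAdj-intro {h} {i} {x} i<h x< y< 3^h∣x-y∓3^i =
  x< , y< , x≢y , i , i<h , Sum.map ∣⇒∣ᵤ ∣⇒∣ᵤ 3^h∣x-y∓3^i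
  where
  cancel₋ : ∀ x d → - ((x - x) - d) ≡ d
  cancel₋ = solve-∀
  cancel₊ : ∀ x d → (x - x) + d ≡ d
  cancel₊ = solve-∀
  x≢y : x ≢ _
  x≢y refl = 3^∤3^ i<h
    ([ (λ 3^h∣ → subst (3^ h ∣_) (cancel₋ (+ x) (3^ i)) (∣m⇒∣-m 3^h∣))
     , (λ 3^h∣ → subst (3^ h ∣_) (cancel₊ (+ x) (3^ i)) 3^h∣)
     ] 3^h∣x-y∓3^i)

nonzero-digit-∣ : ∀ {N i} n r → r ≢ 0ₜ → N ∣ n - toℤ r * 3^ i →
                  (N ∣ n - 3^ i) ⊎ (N ∣ n + 3^ i)
nonzero-digit-∣ {N} {i} n -1ₜ _   N∣ = inj₂ (subst (N ∣_) (identity n (3^ i)) N∣)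
  where
  identity : ∀ n d → n - (- + 1) * d ≡ n + d
  identity = solve-∀
nonzero-digit-∣           _ 0ₜ  r≢0 _  = ⊥-elim (r≢0 refl)
nonzero-digit-∣ {N} {i} n +1ₜ _   N∣ = inj₁ (subst (N ∣_) (identity n (3^ i)) N∣)
  where
  identity : ∀ n d → n - + 1 * d ≡ n - d
  identity = solve-∀

adjacent-by-digit : ∀ {h i v} r → r ≢ 0ₜ → i < h → v < 3 ^ h →
                    ∃[ v′ ] (MCAdj 3 h v v′ × 3^ h ∣ (+ v - toℤ r * 3^ i) - + v′)
adjacent-by-digit {h} {i} {v} r r≢0 i<h v< =
  v′ , MCAdj-intro i<h v< v′< (nonzero-digit-∣ {i = i} (+ v - + v′) r r≢0 3^h∣v-v′-r*3^i) , 3^h∣a-v′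
  where
  instance
    3^h≢0 : ℕ.NonZero (3 ^ h)
    3^h≢0 = ℕP.m^n≢0 3 h
  a : ℤ
  a = + v - toℤ r * 3^ i
  v′ : ℕ
  v′ = a %ℕ 3 ^ h
  v′< : v′ < 3 ^ h
  v′< = n%ℕd<d a (3 ^ h)
  cancel : ∀ b c → (b + c) - b ≡ c
  cancel = solve-∀
  3^h∣a-v′ : 3^ h ∣ a - + v′
  3^h∣a-v′ = divides (a /ℕ 3 ^ h)
    (trans (cong (_- + v′) (a≡a%ℕn+[a/ℕn]*n a (3 ^ h))) (cancel (+ v′) _))
  swap : ∀ v w d → (v - d) - w ≡ (v - w) - d
  swap = solve-∀
  3^h∣v-v′-r*3^i : 3^ h ∣ (+ v - + v′) - toℤ r * 3^ i
  3^h∣v-v′-r*3^i = subst (3^ h ∣_) (swap (+ v) (+ v′) (toℤ r * 3^ i)) 3^h∣a-v′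

DistLe-weaken : ∀ {m h x y j} → DistLe m h x y j → DistLe m h x y (suc j)
DistLe-weaken (k , k≤j , x⇝y) = k , ℕP.m≤n⇒m≤1+n k≤j , x⇝y

DistLe-step : ∀ {m h x y z j} → MCAdj m h x y → DistLe m h y z j → DistLe m h x z (suc j)
DistLe-step x~y (k , k≤j , y⇝z) = suc k , s≤s k≤j , step x~y y⇝z

remove-lowest-digit : ∀ v y r q d → v - y ≡ (r ◂ q) * d → (v - toℤ r * d) - y ≡ q * (+ 3 * d)
remove-lowest-digit v y r q d v-y≡ = begin
  (v - toℤ r * d) - y          ≡⟨ regroup v y (toℤ r * d) ⟩
  (v - y) - toℤ r * d          ≡⟨ cong (_- toℤ r * d) v-y≡ ⟩
  (r ◂ q) * d - toℤ r * d      ≡⟨ expand (toℤ r) q d ⟩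
  q * (+ 3 * d)                ∎
  where
  open ≡-Reasoning
  regroup : ∀ v y e → (v - e) - y ≡ (v - y) - e
  regroup = solve-∀
  expand : ∀ a q d → (a + + 3 * q) * d - a * d ≡ q * (+ 3 * d)
  expand = solve-∀

3^i∣v-y⇒dist≤ : ∀ {h y} → y < 3 ^ h → ∀ j {i v} → i ℕ.+ j ≡ h → v < 3 ^ h →
                3^ i ∣ + v - + y → DistLe 3 h v y j
3^i∣v-y⇒dist≤ {h} {y} y< zero {i} {v} i+0≡h v< 3^i∣v-y =
  0 , z≤n , subst (Walk 3 h 0 v) (≡-mod⇒≡ v< y< 3^h∣v-y) (here v<)
  where
  3^h∣v-y : 3^ h ∣ + v - + y
  3^h∣v-y = subst (λ k → 3^ k ∣ + v - + y) (trans (sym (ℕP.+-identityʳ i)) i+0≡h) 3^i∣v-y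
3^i∣v-y⇒dist≤ {h} {y} y< (suc j) {i} {v} i+[1+j]≡h v< (divides m v-y≡m*3^i)
  with balanced-split m
... | r , q , refl = next r (divides q a-y≡q*3^[1+i])
  where
  1+i+j≡h : suc i ℕ.+ j ≡ h
  1+i+j≡h = trans (sym (ℕP.+-suc i j)) i+[1+j]≡h
  i<h : i < h
  i<h = ℕP.m+n≤o⇒m≤o (suc i) (ℕP.≤-reflexive 1+i+j≡h)
  a-y≡q*3^[1+i] : (+ v - toℤ r * 3^ i) - + y ≡ q * 3^ suc i
  a-y≡q*3^[1+i] = trans (remove-lowest-digit (+ v) (+ y) r q (3^ i) v-y≡m*3^i) (cong (q *_) (sym (3^-suc i)))
  recurse : ∀ {w} → w < 3 ^ h → 3^ suc i ∣ + w - + y → DistLe 3 h w y j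
  recurse = 3^i∣v-y⇒dist≤ y< j 1+i+j≡h
  move : ∀ r → r ≢ 0ₜ → 3^ suc i ∣ (+ v - toℤ r * 3^ i) - + y → DistLe 3 h v y (suc j)
  move r r≢0 3^[1+i]∣a-y with adjacent-by-digit r r≢0 i<h v<
  ... | v′ , v~v′@(_ , v′< , _) , 3^h∣a-v′ =
    DistLe-step v~v′ (recurse v′< (subst (3^ suc i ∣_) (cancel (+ v - toℤ r * 3^ i) (+ y) (+ v′))
      (∣m∣n⇒∣m-n 3^[1+i]∣a-y (∣-trans (3^-mono-∣ i<h) 3^h∣a-v′))))
    where
    cancel : ∀ a y w → (a - y) - (a - w) ≡ w - y
    cancel = solve-∀
  next : ∀ r → 3^ suc i ∣ (+ v - toℤ r * 3^ i) - + y → DistLe 3 h v y (suc j)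
  next -1ₜ = move -1ₜ (λ ())
  next 0ₜ  3^[1+i]∣a-y =
    DistLe-weaken (recurse v< (subst (3^ suc i ∣_) (drop (+ v) (+ y) (3^ i)) 3^[1+i]∣a-y))
    where
    drop : ∀ v y d → (v - + 0 * d) - y ≡ v - y
    drop = solve-∀
  next +1ₜ = move +1ₜ (λ ())

corollary3p17 : (h : ℕ) → 0 < h → HasDiameter 3 h h
corollary3p17 h _ = within-h , repunit h , 0 , repunit<3^ h , ℕP.m^n>0 3 h , at-least-h
  where
  within-h : ∀ x y → x < 3 ^ h → y < 3 ^ h → DistLe 3 h x y h
  within-h x y x< y< = 3^i∣v-y⇒dist≤ y< h refl x< (divides (+ x - + y) (sym (ℤP.*-identityʳ _)))
  at-least-h : ∀ k → Walk 3 h k (repunit h) 0 → h ≤ k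
  at-least-h k w = subst (_≤ k) weight≡h (weight-walk w)
    where
    weight≡h : weight h (+ repunit h - + 0) ≡ h
    weight≡h = trans (cong (weight h) (ℤP.+-identityʳ (+ repunit h))) (weight-repunit h)
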